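{- If $T$ is a tree rooted at $r$ which has the cut-off property, then $a_t(T)=1$. In particular, the vertex $r$ can acquire all the weight.
   Context: Cut-off property: a tree $T$ rooted at $r$ has the cut-off property if for each vertex $v$, its children can be labelled $v_1,\dots,v_k$ so that, writing $T_i$ for the subtree rooted at $v_i$ (consisting of $v_i$ and all its descendants), there exists an integer $i'\ge 0$ (possibly depending on $v$) with $|T_i|=2^{i-1}$ for all $i\le i'$ and $|T_i|\le 2^{i'}$ for all $i>i'$. Total acquisition number: every vertex initially has weight $1$; a total acquisition move transfers all the weight from a vertex $x$ onto an adjacent vertex $y$, allowed only if immediately before the move the weight on $y$ is at least the weight on $x$; a maximal sequence of such moves is an acquisition protocol, the vertices with positive weight at its end form a residual set, and $a_t(G)$ is the minimum possible size of a residual set. -}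

module Defs where

open import Data.Nat using (ℕ; zero; suc; _+_; _^_; _≤_; _<_; _<?_)
open import Data.Fin using (Fin; toℕ)
open import Data.Fin.Permutation using (Permutation′; _⟨$⟩ʳ_)
open import Data.List using (List; _∷_; []; length; filter; concatMap; map; allFin)
open import Data.Nat.ListAction using (sum)
open import Data.Product using (Σ; ∃; _×_; _,_)
open import Data.Sum using (_⊎_)
open import Relation.Nullary using (¬_)
open import Relation.Binary.PropositionalEquality using (_≡_; _≢_)
open import Relation.Binary.Construct.Closure.ReflexiveTransitive using (Star)

data Tree : Set where
  node : (k : ℕ) → (Fin k → Tree) → Tree

size : Tree → ℕ
size (node k f) = suc (sum (map (λ i → size (f i)) (allFin k)))

-- condition at a single vertex with children  f 0 , … , f (k-1)
-- child v_i (1-based i) is  f (π (i-1)) ; |T_i| = 2^(i-1) for i ≤ i',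
-- |T_i| ≤ 2^i' for i > i'.
CutOffAt : (k : ℕ) → (Fin k → Tree) → Set
CutOffAt k f =
  Σ (Permutation′ k) λ π → Σ ℕ λ i' →
    ((j : Fin k) → suc (toℕ j) ≤ i' → size (f (π ⟨$⟩ʳ j)) ≡ 2 ^ toℕ j)
    × ((j : Fin k) → i' < suc (toℕ j) → size (f (π ⟨$⟩ʳ j)) ≤ 2 ^ i')

CutOff : Tree → Set
CutOff (node k f) = CutOffAt k f × ((i : Fin k) → CutOff (f i))

data Pos : Tree → Set where
  here  : ∀ {k f} → Pos (node k f)
  there : ∀ {k f} (i : Fin k) → Pos (f i) → Pos (node k f)

root : (t : Tree) → Pos t
root (node k f) = here

allPos : (t : Tree) → List (Pos t)
allPos (node k f) = here ∷ concatMap (λ i → map (there i) (allPos (f i))) (allFin k)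

data ParentOf : {t : Tree} → Pos t → Pos t → Set where
  root-child : ∀ {k f} (i : Fin k) → ParentOf {node k f} here (there i (root (f i)))
  deeper     : ∀ {k f} (i : Fin k) {p q : Pos (f i)} →
               ParentOf p q → ParentOf {node k f} (there i p) (there i q)

Adj : {t : Tree} → Pos t → Pos t → Set
Adj p q = ParentOf p q ⊎ ParentOf q p

Config : Tree → Set
Config t = Pos t → ℕ

initial : (t : Tree) → Config t
initial t _ = 1

Move : {t : Tree} → Config t → Config t → Set
Move {t} w w' = Σ (Pos t) λ x → Σ (Pos t) λ y →
  Adj x y × 0 < w x × w x ≤ w y
  × w' x ≡ 0 × w' y ≡ w y + w x
  × ((z : Pos t) → z ≢ x → z ≢ y → w' z ≡ w z)

Terminal : {t : Tree} → Config t → Set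
Terminal w = ¬ (∃ λ w' → Move w w')

-- w is the final configuration of an acquisition protocol
-- (a maximal sequence of moves starting from weight 1 everywhere)
Protocol : (t : Tree) → Config t → Set
Protocol t w = Star (Move {t}) (initial t) w × Terminal w

residualSize : {t : Tree} → Config t → ℕ
residualSize {t} w = length (filter (λ v → 0 <? w v) (allPos t))

TotalAcqNumber : Tree → ℕ → Set
TotalAcqNumber t m =
  (Σ (Config t) λ w → Protocol t w × residualSize w ≡ m)
  × ((w : Config t) → Protocol t w → m ≤ residualSize w)

RootAcquiresAll : Tree → Set
RootAcquiresAll t = Σ (Config t) λ w → Protocol t w × w (root t) ≡ size t

-- Lower bound: a move never destroys all weight (the receiving vertex
-- ends up with positive weight), so every residual set is non-empty.
--
-- Upper bound, by induction on the tree: the root can gather all the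
-- weight.  At each vertex, let every child subtree concentrate its weight
-- on its own root, then move it to the vertex, taking the children in the
-- cut-off order.  A move is legal when the child's size is at most the
-- weight gathered so far (an *absorbable* size sequence): the sizes
-- 1, 2, …, 2^(i'-1) keep the gathered weight equal to 2^e, after which it
-- is at least 2^i', bounding all remaining sizes.  The final configuration
-- is terminal with residual set {root}.
module Submission where

open import Defs
open import Data.Product using (_×_; Σ; ∃; _,_)
open import Data.Sum using (inj₁; inj₂)
open import Data.Nat using (ℕ; zero; suc; _+_; _^_; _≤_; _<_; _<?_; z≤n; s≤s)
open import Data.Nat.Properties
  using (+-assoc; +-identityʳ; +-suc; +-0-commutativeMonoid; ≤-trans; ≤-reflexive;
         ≤-antisym; ≮⇒≥; m≤m+n; <-irrefl)
open import Data.Nat.ListAction using (sum)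
open import Data.Bool using (Bool; true; false)
open import Data.Unit using (⊤; tt)
open import Data.Empty using (⊥-elim)
open import Data.Fin using (Fin; toℕ) renaming (zero to fzero; suc to fsuc)
import Data.Fin.Properties as Fin
open import Data.Fin.Permutation using (Permutation′; _⟨$⟩ʳ_; _⟨$⟩ˡ_; inverseˡ; inverseʳ)
open import Data.List using (List; _∷_; length; concatMap; map; allFin; tabulate)
import Data.List.Properties as List
open import Data.List.Relation.Unary.All using (All; universal)
import Data.List.Relation.Unary.All.Properties as All
import Data.List.Relation.Unary.Any as Any
open import Data.List.Membership.Propositional using (_∈_)
open import Data.List.Membership.Propositional.Properties
  using (∈-map⁺; ∈-concatMap⁺; ∈-filter⁺; ∈-allFin)
open import Relation.Nullary using (Dec; yes; no)
open import Relation.Binary.PropositionalEquality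
open import Relation.Binary.Construct.Closure.ReflexiveTransitive using (Star; ε; _◅_; _◅◅_)
open import Function using (_∘_)
open import Function.Definitions using (Injective)
import Algebra.Properties.CommutativeMonoid.Sum as MonoidSum

open MonoidSum +-0-commutativeMonoid using () renaming (sum to ∑; sum-permute to ∑-permute)

-- The list sums (used by  size  over  allFin k = tabulate id) agree with sums over Fin.
sum-tabulate : {A : Set} {k : ℕ} (h : A → ℕ) (g : Fin k → A) →
               sum (map h (tabulate g)) ≡ ∑ (h ∘ g)
sum-tabulate {k = zero} h g = refl
sum-tabulate {k = suc k} h g = cong (h (g fzero) +_) (sum-tabulate h (g ∘ fsuc))

size-positive : (t : Tree) → 0 < size t
size-positive (node k f) = s≤s z≤n

permutation-injective : {k : ℕ} (π : Permutation′ k) → Injective _≡_ _≡_ (π ⟨$⟩ʳ_)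
permutation-injective π {x} {y} eq =
  trans (sym (inverseˡ π)) (trans (cong (π ⟨$⟩ˡ_) eq) (inverseˡ π))

_⇝_ : {t : Tree} → Config t → Config t → Set
_⇝_ {t} w u = Σ (Config t) λ u' → Star (Move {t}) w u' × u' ≗ u

move-resp : {t : Tree} {w w₀ u u₀ : Config t} → Move w u → w₀ ≗ w → u ≗ u₀ → Move w₀ u₀
move-resp (x , y , adj , pos , le , ux , uy , frame) e₁ e₂ =
  x , y , adj , subst (0 <_) (sym (e₁ x)) pos ,
  subst₂ _≤_ (sym (e₁ x)) (sym (e₁ y)) le ,
  trans (sym (e₂ x)) ux ,
  trans (sym (e₂ y)) (trans uy (cong₂ _+_ (sym (e₁ y)) (sym (e₁ x)))) ,
  λ z z≢x z≢y → trans (sym (e₂ z)) (trans (frame z z≢x z≢y) (sym (e₁ z)))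

⇝-refl : {t : Tree} {w : Config t} → w ⇝ w
⇝-refl = _ , ε , λ _ → refl

⇝-step : {t : Tree} {w u : Config t} → Move w u → w ⇝ u
⇝-step m = _ , m ◅ ε , λ _ → refl

⇝-resp-src : {t : Tree} {w w₀ u : Config t} → w₀ ≗ w → w ⇝ u → w₀ ⇝ u
⇝-resp-src {w₀ = w₀} e (u' , ε , e') = w₀ , ε , λ p → trans (e p) (e' p)
⇝-resp-src e (u' , m ◅ s , e') = u' , move-resp m e (λ _ → refl) ◅ s , e'

⇝-resp-tgt : {t : Tree} {w u v : Config t} → w ⇝ u → u ≗ v → w ⇝ v
⇝-resp-tgt (u' , s , e) e' = u' , s , λ p → trans (e p) (e' p)

⇝-trans : {t : Tree} {w u v : Config t} → w ⇝ u → u ⇝ v → w ⇝ v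
⇝-trans (u' , s , e) r with ⇝-resp-src e r
... | v' , s' , e' = v' , s ◅◅ s' , e'

module Subtree {k : ℕ} {f : Fin k → Tree} where

  replace : Config (node k f) → (i : Fin k) → Config (f i) → Config (node k f)
  replace w i u here = w here
  replace w i u (there j q) with j Fin.≟ i
  ... | yes refl = u q
  ... | no _ = w (there j q)

  replace-inside : (w : Config (node k f)) (i : Fin k) (u : Config (f i)) (q : Pos (f i)) →
                   replace w i u (there i q) ≡ u q
  replace-inside w i u q with i Fin.≟ i
  ... | yes refl = refl
  ... | no i≢i = ⊥-elim (i≢i refl)

  replace-outside : (w : Config (node k f)) (i : Fin k) (u : Config (f i)) (j : Fin k)
                    (q : Pos (f j)) → j ≢ i → replace w i u (there j q) ≡ w (there j q)
  replace-outside w i u j q j≢i with j Fin.≟ i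
  ... | yes j≡i = ⊥-elim (j≢i j≡i)
  ... | no _ = refl

  replace-cong : (w : Config (node k f)) (i : Fin k) {u v : Config (f i)} →
                 u ≗ v → replace w i u ≗ replace w i v
  replace-cong w i e here = refl
  replace-cong w i e (there j q) with j Fin.≟ i
  ... | yes refl = e q
  ... | no _ = refl

  lift-move : (w : Config (node k f)) (i : Fin k) {u v : Config (f i)} →
              Move u v → Move (replace w i u) (replace w i v)
  lift-move w i {u} {v} (x , y , adj , pos , le , vx , vy , frame) =
    there i x , there i y , lift-adj adj ,
    subst (0 <_) (sym (inside u x)) pos ,
    subst₂ _≤_ (sym (inside u x)) (sym (inside u y)) le ,
    trans (inside v x) vx ,
    trans (inside v y) (trans vy (cong₂ _+_ (sym (inside u y)) (sym (inside u x)))) ,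
    frame′
    where
    inside : (u : Config (f i)) (q : Pos (f i)) → replace w i u (there i q) ≡ u q
    inside = replace-inside w i
    lift-adj : Adj x y → Adj {node k f} (there i x) (there i y)
    lift-adj (inj₁ p) = inj₁ (deeper i p)
    lift-adj (inj₂ p) = inj₂ (deeper i p)
    frame′ : (z : Pos (node k f)) → z ≢ there i x → z ≢ there i y →
             replace w i v z ≡ replace w i u z
    frame′ here _ _ = refl
    frame′ (there j q) z≢x z≢y with j Fin.≟ i
    ... | yes refl = frame q (z≢x ∘ cong (there i)) (z≢y ∘ cong (there i))
    ... | no _ = refl

  lift-star : (w : Config (node k f)) (i : Fin k) {u v : Config (f i)} →
              Star (Move {f i}) u v → replace w i u ⇝ replace w i v
  lift-star w i ε = ⇝-refl
  lift-star w i (m ◅ s) = ⇝-trans (⇝-step (lift-move w i m)) (lift-star w i s)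

  lift : (w : Config (node k f)) (i : Fin k) {u v : Config (f i)} →
         u ⇝ v → replace w i u ⇝ replace w i v
  lift w i (u' , s , e) = ⇝-resp-tgt (lift-star w i s) (replace-cong w i e)

concentrated : (t : Tree) → ℕ → Config t
concentrated (node k f) s here = s
concentrated (node k f) s (there _ _) = 0

concentrated-root : (t : Tree) (s : ℕ) → concentrated t s (root t) ≡ s
concentrated-root (node k f) s = refl

concentrated-nonroot : (t : Tree) (s : ℕ) (q : Pos t) → q ≢ root t → concentrated t s q ≡ 0
concentrated-nonroot (node k f) s here q≢r = ⊥-elim (q≢r refl)
concentrated-nonroot (node k f) s (there _ _) _ = refl

-- No move is possible: non-roots are empty and the root's neighbours
-- have less weight than it.
concentrated-terminal : (t : Tree) (s : ℕ) (u : Config t) → u ≗ concentrated t s → Terminal u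
concentrated-terminal (node k f) s u e (_ , here , here , inj₁ () , _)
concentrated-terminal (node k f) s u e (_ , here , here , inj₂ () , _)
concentrated-terminal (node k f) s u e (_ , here , there j q , _ , pos , le , _) =
  <-irrefl refl (≤-trans pos (subst (u here ≤_) (e (there j q)) le))
concentrated-terminal (node k f) s u e (_ , there j q , _ , _ , pos , _) =
  <-irrefl refl (subst (0 <_) (e (there j q)) pos)

non-roots-all : {k : ℕ} {f : Fin k → Tree} (Q : Pos (node k f) → Set) →
                (∀ j q → Q (there j q)) →
                All Q (concatMap (λ i → map (there i) (allPos (f i))) (allFin k))
non-roots-all {k} {f} Q Q-there =
  All.concat⁺ (All.map⁺ {f = λ i → map (there i) (allPos (f i))}
    (universal (λ i → All.map⁺ (universal (Q-there i) (allPos (f i)))) (allFin k)))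

concentrated-residual : (t : Tree) (s : ℕ) (u : Config t) → 0 < s →
                        u ≗ concentrated t s → residualSize u ≡ 1
concentrated-residual (node k f) s u 0<s e =
  cong length (trans (List.filter-accept positive? (subst (0 <_) (sym (e here)) 0<s))
    (cong (here ∷_) (List.filter-none positive?
      (non-roots-all _ (λ j q pos → <-irrefl refl (subst (0 <_) (e (there j q)) pos))))))
  where
  positive? : (v : Pos (node k f)) → Dec (0 < u v)
  positive? v = 0 <? u v

-- Starting with weight a on the root, the sizes h 0, h 1, … can be
-- absorbed in order: each is at most the weight accumulated so far.
Absorbable : ℕ → (n : ℕ) → (Fin n → ℕ) → Set
Absorbable a zero h = ⊤
Absorbable a (suc n) h = h fzero ≤ a × Absorbable (a + h fzero) n (h ∘ fsuc)

absorbable-bounded : (B a n : ℕ) (h : Fin n → ℕ) → B ≤ a → (∀ j → h j ≤ B) →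
                     Absorbable a n h
absorbable-bounded B a zero h _ _ = tt
absorbable-bounded B a (suc n) h B≤a h≤B =
  ≤-trans (h≤B fzero) B≤a ,
  absorbable-bounded B (a + h fzero) n (h ∘ fsuc) (≤-trans B≤a (m≤m+n a _)) (h≤B ∘ fsuc)

-- The cut-off condition from position e on, with accumulated weight 2^e:
-- sizes 2^e, 2^(e+1), … up to position i', then sizes at most 2^i'.
absorbable-cutoff : (i' e n : ℕ) (h : Fin n → ℕ) → e ≤ i' →
  (∀ j → e + toℕ j < i' → h j ≡ 2 ^ (e + toℕ j)) →
  (∀ j → i' ≤ e + toℕ j → h j ≤ 2 ^ i') →
  Absorbable (2 ^ e) n h
absorbable-cutoff i' e zero h _ _ _ = tt
absorbable-cutoff i' e (suc n) h e≤i' doubling capped with e <? i'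
... | yes e<i' =
  ≤-reflexive h₀≡2^e ,
  subst (λ a → Absorbable a n (h ∘ fsuc)) (sym doubled)
    (absorbable-cutoff i' (suc e) n (h ∘ fsuc) e<i' doubling′ capped′)
  where
  h₀≡2^e : h fzero ≡ 2 ^ e
  h₀≡2^e = trans (doubling fzero (subst (_< i') (sym (+-identityʳ e)) e<i'))
                 (cong (2 ^_) (+-identityʳ e))
  doubled : 2 ^ e + h fzero ≡ 2 ^ suc e
  doubled = trans (cong (2 ^ e +_) h₀≡2^e) (cong (2 ^ e +_) (sym (+-identityʳ (2 ^ e))))
  doubling′ : ∀ j → suc e + toℕ j < i' → h (fsuc j) ≡ 2 ^ (suc e + toℕ j)
  doubling′ j p = trans (doubling (fsuc j) (subst (_< i') (sym (+-suc e (toℕ j))) p))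
                        (cong (2 ^_) (+-suc e (toℕ j)))
  capped′ : ∀ j → i' ≤ suc e + toℕ j → h (fsuc j) ≤ 2 ^ i'
  capped′ j p = capped (fsuc j) (subst (i' ≤_) (sym (+-suc e (toℕ j))) p)
... | no e≮i' =
  absorbable-bounded (2 ^ i') (2 ^ e) (suc n) h (≤-reflexive (cong (2 ^_) i'≡e))
    (λ j → capped j (≤-trans (≤-reflexive i'≡e) (m≤m+n e (toℕ j))))
  where
  i'≡e : i' ≡ e
  i'≡e = ≤-antisym (≮⇒≥ e≮i') e≤i'

cutoff-absorbable : {k : ℕ} {f : Fin k → Tree} → ((π , _) : CutOffAt k f) →
                    Absorbable 1 k (λ j → size (f (π ⟨$⟩ʳ j)))
cutoff-absorbable {k} (π , i' , small , large) =
  absorbable-cutoff i' 0 k _ z≤n small (λ j i'≤j → large j (s≤s i'≤j))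

module Absorb {k : ℕ} {f : Fin k → Tree} where
  open Subtree {k} {f}

  -- the root holds a; children marked done are empty, the others are
  -- untouched (weight 1 everywhere)
  stage : ℕ → (Fin k → Bool) → Config (node k f)
  stage a done here = a
  stage a done (there c q) with done c
  ... | true = 0
  ... | false = 1

  stage-done : (a : ℕ) (done : Fin k → Bool) (j : Fin k) (q : Pos (f j)) →
               done j ≡ true → stage a done (there j q) ≡ 0
  stage-done a done j q dj with done j
  ... | true = refl

  stage-pending : (a : ℕ) (done : Fin k → Bool) (j : Fin k) (q : Pos (f j)) →
                  done j ≡ false → stage a done (there j q) ≡ 1
  stage-pending a done j q dj with done j
  ... | false = refl

  stage-agree : (a b : ℕ) (done done' : Fin k → Bool) (j : Fin k) (q : Pos (f j)) →
                done j ≡ done' j → stage a done (there j q) ≡ stage b done' (there j q)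
  stage-agree a b done done' j q e with done j | done' j
  stage-agree a b done done' j q refl | true | true = refl
  stage-agree a b done done' j q refl | false | false = refl

  mark : (Fin k → Bool) → Fin k → Fin k → Bool
  mark done c j with j Fin.≟ c
  ... | yes _ = true
  ... | no _ = done j

  mark-same : (done : Fin k → Bool) (c : Fin k) → mark done c c ≡ true
  mark-same done c with c Fin.≟ c
  ... | yes _ = refl
  ... | no c≢c = ⊥-elim (c≢c refl)

  mark-other : (done : Fin k → Bool) (c j : Fin k) → j ≢ c → mark done c j ≡ done j
  mark-other done c j j≢c with j Fin.≟ c
  ... | yes j≡c = ⊥-elim (j≢c j≡c)
  ... | no _ = refl

  mark-grows : (done : Fin k → Bool) (c j : Fin k) → done j ≡ true → mark done c j ≡ true
  mark-grows done c j dj with j Fin.≟ c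
  ... | yes _ = refl
  ... | no _ = dj

  stage-pending-initial : (a : ℕ) (done : Fin k → Bool) (c : Fin k) → done c ≡ false →
                          stage a done ≗ replace (stage a done) c (initial (f c))
  stage-pending-initial a done c dc here = refl
  stage-pending-initial a done c dc (there j q) with j Fin.≟ c
  ... | yes refl = stage-pending a done c q dc
  ... | no _ = refl

  absorb-move : (a : ℕ) (done : Fin k → Bool) (c : Fin k) → size (f c) ≤ a →
    Move (replace (stage a done) c (concentrated (f c) (size (f c))))
         (stage (a + size (f c)) (mark done c))
  absorb-move a done c s≤a =
    there c (root (f c)) , here , inj₂ (root-child c) ,
    subst (0 <_) (sym child-root) (size-positive (f c)) ,
    subst (_≤ a) (sym child-root) s≤a ,
    stage-done (a + s) (mark done c) c (root (f c)) (mark-same done c) ,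
    cong (a +_) (sym child-root) ,
    frame
    where
    s : ℕ
    s = size (f c)
    before : Config (node k f)
    before = replace (stage a done) c (concentrated (f c) s)
    child-root : before (there c (root (f c))) ≡ s
    child-root = trans (replace-inside _ c _ (root (f c))) (concentrated-root (f c) s)
    frame : (z : Pos (node k f)) → z ≢ there c (root (f c)) → z ≢ here →
            stage (a + s) (mark done c) z ≡ before z
    frame here _ z≢here = ⊥-elim (z≢here refl)
    frame (there j q) z≢r _ = frame-child (j Fin.≟ c) q z≢r
      where
      -- a separate function, so that deciding  j ≡ c  leaves  mark  intact
      frame-child : Dec (j ≡ c) → (q : Pos (f j)) → there j q ≢ there c (root (f c)) →
                    stage (a + s) (mark done c) (there j q) ≡ before (there j q)
      frame-child (yes refl) q z≢r =
        trans (stage-done (a + s) (mark done c) c q (mark-same done c))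
              (sym (trans (replace-inside _ c _ q)
                          (concentrated-nonroot (f c) s q (z≢r ∘ cong (there c)))))
      frame-child (no j≢c) q _ =
        trans (stage-agree (a + s) a (mark done c) done j q (mark-other done c j j≢c))
              (sym (replace-outside _ c _ j q j≢c))

  module _ (gather : (c : Fin k) → initial (f c) ⇝ concentrated (f c) (size (f c))) where

    absorb-child : (a : ℕ) (done : Fin k → Bool) (c : Fin k) → done c ≡ false →
                   size (f c) ≤ a → stage a done ⇝ stage (a + size (f c)) (mark done c)
    absorb-child a done c dc s≤a =
      ⇝-resp-src (stage-pending-initial a done c dc)
        (⇝-trans (lift (stage a done) c (gather c)) (⇝-step (absorb-move a done c s≤a)))

    absorb-all : (n : ℕ) (σ : Fin n → Fin k) → Injective _≡_ _≡_ σ →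
      (a : ℕ) (done : Fin k → Bool) → (∀ j → done (σ j) ≡ false) →
      Absorbable a n (λ j → size (f (σ j))) →
      Σ (Fin k → Bool) λ done' →
        stage a done ⇝ stage (a + ∑ (λ j → size (f (σ j)))) done'
        × (∀ c → done c ≡ true → done' c ≡ true) × (∀ j → done' (σ j) ≡ true)
    absorb-all zero σ _ a done _ _ =
      done , ⇝-resp-tgt ⇝-refl (λ p → cong (λ b → stage b done p) (sym (+-identityʳ a))) ,
      (λ _ dc → dc) , λ ()
    absorb-all (suc n) σ σ-inj a done pending (s≤a , rest)
      with absorb-all n (σ ∘ fsuc) (Fin.suc-injective ∘ σ-inj) (a + size (f (σ fzero)))
             (mark done (σ fzero)) pending′ rest
      where
      pending′ : ∀ j → mark done (σ fzero) (σ (fsuc j)) ≡ false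
      pending′ j = trans (mark-other done (σ fzero) (σ (fsuc j))
                           (λ e → Fin.0≢1+n (sym (σ-inj e)))) (pending (fsuc j))
    ... | done' , reach , grows , all-done =
      done' ,
      ⇝-resp-tgt (⇝-trans (absorb-child a done (σ fzero) (pending fzero) s≤a) reach)
        (λ p → cong (λ b → stage b done' p) (+-assoc a _ _)) ,
      (λ c dc → grows c (mark-grows done (σ fzero) c dc)) ,
      λ { fzero → grows (σ fzero) (mark-same done (σ fzero)) ; (fsuc j) → all-done j }

gather-all : (t : Tree) → CutOff t → initial t ⇝ concentrated t (size t)
gather-all (node k f) (cutoff@(π , _) , children)
  with Absorb.absorb-all {k} {f} (λ c → gather-all (f c) (children c)) k (π ⟨$⟩ʳ_)
         (permutation-injective π) 1 (λ _ → false) (λ _ → refl) (cutoff-absorbable {k} {f} cutoff)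
... | done , reach , _ , all-done =
  ⇝-resp-src start (⇝-resp-tgt reach finish)
  where
  open Absorb {k} {f}
  start : initial (node k f) ≗ stage 1 (λ _ → false)
  start here = refl
  start (there j q) = sym (stage-pending 1 _ j q refl)
  gathered : ℕ
  gathered = 1 + ∑ (λ j → size (f (π ⟨$⟩ʳ j)))
  gathered≡size : gathered ≡ size (node k f)
  gathered≡size = cong suc (trans (sym (∑-permute (size ∘ f) π))
                                  (sym (sum-tabulate (size ∘ f) (λ i → i))))
  finish : stage gathered done ≗ concentrated (node k f) (size (node k f))
  finish here = gathered≡size
  finish (there j q) = stage-done gathered done j q
    (subst (λ c → done c ≡ true) (inverseʳ π) (all-done (π ⟨$⟩ˡ j)))

positive-persists : {t : Tree} {w u : Config t} → Star (Move {t}) w u →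
                    (∃ λ v → 0 < w v) → ∃ λ v → 0 < u v
positive-persists ε p = p
positive-persists {w = w} ((x , y , _ , pos , le , _ , uy , _) ◅ s) _ =
  positive-persists s (y , subst (0 <_) (sym uy) (≤-trans (≤-trans pos le) (m≤m+n (w y) (w x))))

allPos-complete : (t : Tree) (v : Pos t) → v ∈ allPos t
allPos-complete (node k f) here = Any.here refl
allPos-complete (node k f) (there i p) =
  Any.there (∈-concatMap⁺ (λ j → map (there j) (allPos (f j)))
    (Any.map (λ { refl → ∈-map⁺ (there i) (allPos-complete (f i) p) }) (∈-allFin i)))

nonempty-length : {A : Set} {x : A} {xs : List A} → x ∈ xs → 1 ≤ length xs
nonempty-length (Any.here _) = s≤s z≤n
nonempty-length (Any.there _) = s≤s z≤n

residual-nonempty : (t : Tree) (w : Config t) → Protocol t w → 1 ≤ residualSize w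
residual-nonempty t w (steps , _) with positive-persists steps (root t , s≤s z≤n)
... | v , pos = nonempty-length (∈-filter⁺ (λ v → 0 <? w v) (allPos-complete t v) pos)

lemma2p2 : (t : Tree) → CutOff t → TotalAcqNumber t 1 × RootAcquiresAll t
lemma2p2 t cutoff with gather-all t cutoff
... | u , steps , u≗ = (optimal , residual-nonempty t) , (u , protocol , acquires)
  where
  protocol : Protocol t u
  protocol = steps , concentrated-terminal t (size t) u u≗
  optimal : Σ (Config t) λ w → Protocol t w × residualSize w ≡ 1
  optimal = u , protocol , concentrated-residual t (size t) u (size-positive t) u≗
  acquires : u (root t) ≡ size t
  acquires = trans (u≗ (root t)) (concentrated-root t (size t))
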